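{- The reduction relation $\rightarrow_{\beta\pi\sigma\mu}$ of $\lambda\mathbf{J}^{\mathbf{ms}}$ is confluent.
   Context: $\lambda\mathbf{J}^{\mathbf{ms}}$: terms $t,u,v::=x\mid\lambda x.t\mid t\,l$; co-terms $l::=u::l\mid(x)v$ ($(x)$ binds $x$ in $v$; capture-avoiding substitution $[t/x]$). A value $V$ is a variable or a $\lambda$-abstraction. Append: $(u::l)@l'=u::(l@l')$, $((x)V)@l'=(x)(V\,l')$ for $V$ a value, $((x)t\,l)@l'=(x)t\,(l@l')$. The reduction is the closure under all constructors of: $(\beta)\ (\lambda x.t)(u::l)\rightarrow u((x)t\,l)$; $(\sigma)\ t(x)v\rightarrow[t/x]v$; $(\pi)\ (t\,l)(u::l')\rightarrow t\,(l@(u::l'))$; $(\mu)\ (x)x\,l\rightarrow l$ if $x$ not free in $l$. Confluence: whenever $t\rightarrow^*t_1$ and $t\rightarrow^*t_2$ there is $t_3$ with $t_i\rightarrow^*t_3$, $i=1,2$. -}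

module Defs where

open import Data.Nat using (ℕ; zero; suc)
open import Data.Fin using (Fin; zero; suc)
open import Data.Product using (∃; _×_; _,_)
open import Relation.Binary.Construct.Closure.ReflexiveTransitive using (Star)

-- Well-scoped de Bruijn syntax of λJ^ms.  'Tm n' / 'CoTm n' have at most
-- n free variables; binders (λx.t and (x)v) bind de Bruijn index 0.
mutual
  data Tm (n : ℕ) : Set where
    var : Fin n → Tm n
    lam : Tm (suc n) → Tm n
    app : Tm n → CoTm n → Tm n

  data CoTm (n : ℕ) : Set where
    _∷_ : Tm n → CoTm n → CoTm n
    bnd : Tm (suc n) → CoTm n

infixr 5 _∷_

Ren : ℕ → ℕ → Set
Ren n m = Fin n → Fin m

extR : ∀ {n m} → Ren n m → Ren (suc n) (suc m)
extR ρ zero    = zero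
extR ρ (suc i) = suc (ρ i)

mutual
  ren : ∀ {n m} → Ren n m → Tm n → Tm m
  ren ρ (var i)   = var (ρ i)
  ren ρ (lam t)   = lam (ren (extR ρ) t)
  ren ρ (app t l) = app (ren ρ t) (renC ρ l)

  renC : ∀ {n m} → Ren n m → CoTm n → CoTm m
  renC ρ (u ∷ l) = ren ρ u ∷ renC ρ l
  renC ρ (bnd v) = bnd (ren (extR ρ) v)

wk : ∀ {n} → Tm n → Tm (suc n)
wk = ren suc

wkC : ∀ {n} → CoTm n → CoTm (suc n)
wkC = renC suc

Sub : ℕ → ℕ → Set
Sub n m = Fin n → Tm m

extS : ∀ {n m} → Sub n m → Sub (suc n) (suc m)
extS σ zero    = var zero
extS σ (suc i) = wk (σ i)

mutual
  sub : ∀ {n m} → Sub n m → Tm n → Tm m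
  sub σ (var i)   = σ i
  sub σ (lam t)   = lam (sub (extS σ) t)
  sub σ (app t l) = app (sub σ t) (subC σ l)

  subC : ∀ {n m} → Sub n m → CoTm n → CoTm m
  subC σ (u ∷ l) = sub σ u ∷ subC σ l
  subC σ (bnd v) = bnd (sub (extS σ) v)

single : ∀ {n} → Tm n → Sub (suc n) n
single t zero    = t
single t (suc i) = var i

_[_/0] : ∀ {n} → Tm (suc n) → Tm n → Tm n
v [ t /0] = sub (single t) v

-- Append l ++ l'
--   (u::l)@l' = u::(l@l'),  ((x)V)@l' = (x)(V l') for V a value,
--   ((x)t l)@l' = (x)t (l@l')     (l' weakened under the binder (x))
_++_ : ∀ {n} → CoTm n → CoTm n → CoTm n
(u ∷ l)         ++ l' = u ∷ (l ++ l')
bnd (var x)     ++ l' = bnd (app (var x) (wkC l'))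
bnd (lam t)     ++ l' = bnd (app (lam t) (wkC l'))
bnd (app t l)   ++ l' = bnd (app t (l ++ wkC l'))

mutual
  data _⟶_ {n : ℕ} : Tm n → Tm n → Set where
    β  : ∀ {t u l} → app (lam t) (u ∷ l) ⟶ app u (bnd (app t (wkC l)))
    σ  : ∀ {t v} → app t (bnd v) ⟶ (v [ t /0])
    π  : ∀ {t l u l'} → app (app t l) (u ∷ l') ⟶ app t (l ++ (u ∷ l'))
    ξλ : ∀ {t t'} → t ⟶ t' → lam t ⟶ lam t'
    ξ₁ : ∀ {t t' l} → t ⟶ t' → app t l ⟶ app t' l
    ξ₂ : ∀ {t l l'} → l ⟶ᶜ l' → app t l ⟶ app t l'

  data _⟶ᶜ_ {n : ℕ} : CoTm n → CoTm n → Set where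
    -- (μ)  (x) x l → l   if x ∉ FV(l), i.e. the body's co-term is a weakening
    μ  : ∀ {l} → bnd (app (var zero) (wkC l)) ⟶ᶜ l
    ξ∷₁ : ∀ {u u' l} → u ⟶ u' → (u ∷ l) ⟶ᶜ (u' ∷ l)
    ξ∷₂ : ∀ {u l l'} → l ⟶ᶜ l' → (u ∷ l) ⟶ᶜ (u ∷ l')
    ξbnd : ∀ {v v'} → v ⟶ v' → bnd v ⟶ᶜ bnd v'

_⟶*_ : ∀ {n} → Tm n → Tm n → Set
_⟶*_ = Star _⟶_

Confluent : Set
Confluent = ∀ {n} {t t₁ t₂ : Tm n} → t ⟶* t₁ → t ⟶* t₂ →
            ∃ λ t₃ → (t₁ ⟶* t₃) × (t₂ ⟶* t₃)

-- The π-rule spoils a direct Tait–Martin-Löf argument, so we work modulo π.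
-- Every term reduces to its π-normal form πnf t, and a single step
-- t ⟶ t' becomes a parallel step πnf t ⇛ πnf t', where ⇛ rebuilds applications
-- with their π-redex contracted (_⊛_) and substitutes without creating π-redexes
-- (msub).  The relation ⇛ has the triangle property with respect to a complete
-- development dev, which also contracts the μ-redexes it creates (bndμ, deciding
-- x ∉ l by strengthening); hence ⇛* is confluent.  As ⇛ ⊆ ⟶*, a common reduct of
-- πnf t₁ and πnf t₂ is a common reduct of t₁ and t₂.

module Submission where

open import Data.Nat using (ℕ; zero; suc)
open import Data.Fin using (Fin; zero; suc)
open import Data.Fin.Properties using (suc-injective)
open import Data.Maybe using (Maybe; just; nothing; map; zipWith)
open import Data.Product using (∃; ∃₂; _×_; _,_)
open import Data.Sum using (_⊎_; inj₁; inj₂)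
open import Relation.Binary.PropositionalEquality
open import Relation.Binary.Construct.Closure.ReflexiveTransitive
  using (Star; ε; _◅_; _◅◅_; gmap)
open import Relation.Binary.Core using (Rel)
import Relation.Binary.Rewriting as Rewriting
open import Defs

var-injective : ∀ {n} {i j : Fin n} → var i ≡ var j → i ≡ j
var-injective refl = refl

lam-injective : ∀ {n} {t u : Tm (suc n)} → lam t ≡ lam u → t ≡ u
lam-injective refl = refl

app-injectiveˡ : ∀ {n} {t t' : Tm n} {l l'} → app t l ≡ app t' l' → t ≡ t'
app-injectiveˡ refl = refl

app-injectiveʳ : ∀ {n} {t t' : Tm n} {l l'} → app t l ≡ app t' l' → l ≡ l'
app-injectiveʳ refl = refl

∷-injectiveˡ : ∀ {n} {t t' : Tm n} {l l'} → (t ∷ l) ≡ (t' ∷ l') → t ≡ t'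
∷-injectiveˡ refl = refl

∷-injectiveʳ : ∀ {n} {t t' : Tm n} {l l'} → (t ∷ l) ≡ (t' ∷ l') → l ≡ l'
∷-injectiveʳ refl = refl

bnd-injective : ∀ {n} {t u : Tm (suc n)} → bnd t ≡ bnd u → t ≡ u
bnd-injective refl = refl

extR-comp : ∀ {n m k} {r : Ren m k} {q : Ren n m} {p : Ren n k} →
  (∀ i → r (q i) ≡ p i) → ∀ i → extR r (extR q i) ≡ extR p i
extR-comp e zero    = refl
extR-comp e (suc i) = cong suc (e i)

mutual
  ren-ren : ∀ {n m k} {r : Ren m k} {q : Ren n m} {p : Ren n k} →
    (∀ i → r (q i) ≡ p i) → ∀ t → ren r (ren q t) ≡ ren p t
  ren-ren e (var i)   = cong var (e i)
  ren-ren e (lam t)   = cong lam (ren-ren (extR-comp e) t)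
  ren-ren e (app t l) = cong₂ app (ren-ren e t) (renC-ren e l)

  renC-ren : ∀ {n m k} {r : Ren m k} {q : Ren n m} {p : Ren n k} →
    (∀ i → r (q i) ≡ p i) → ∀ l → renC r (renC q l) ≡ renC p l
  renC-ren e (u ∷ l) = cong₂ _∷_ (ren-ren e u) (renC-ren e l)
  renC-ren e (bnd v) = cong bnd (ren-ren (extR-comp e) v)

ren-extR-wk : ∀ {n m} (r : Ren n m) t → ren (extR r) (wk t) ≡ wk (ren r t)
ren-extR-wk r t = trans (ren-ren (λ _ → refl) t) (sym (ren-ren (λ _ → refl) t))

renC-extR-wkC : ∀ {n m} (r : Ren n m) l → renC (extR r) (wkC l) ≡ wkC (renC r l)
renC-extR-wkC r l = trans (renC-ren (λ _ → refl) l) (sym (renC-ren (λ _ → refl) l))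

-- t ⊛ l is the application t l with the π-redex it forms at the root, if any,
-- contracted.
infixl 30 _⊙_ _⊛_

_⊙_ : ∀ {n} → Tm n → CoTm n → Tm n
app t l ⊙ l' = app t (l ++ l')
var i   ⊙ l' = app (var i) l'
lam t   ⊙ l' = app (lam t) l'

_⊛_ : ∀ {n} → Tm n → CoTm n → Tm n
t ⊛ (u ∷ l) = t ⊙ (u ∷ l)
t ⊛ bnd v   = app t (bnd v)

bnd-++ : ∀ {n} (v : Tm (suc n)) l → bnd v ++ l ≡ bnd (v ⊙ wkC l)
bnd-++ (var x)   l = refl
bnd-++ (lam v)   l = refl
bnd-++ (app v m) l = refl

var-⊛ : ∀ {n} (i : Fin n) l → var i ⊛ l ≡ app (var i) l
var-⊛ i (u ∷ l) = refl
var-⊛ i (bnd v) = refl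

mutual
  ren-⊙ : ∀ {n m} (r : Ren n m) t l → ren r (t ⊙ l) ≡ ren r t ⊙ renC r l
  ren-⊙ r (var x)   l = refl
  ren-⊙ r (lam t)   l = refl
  ren-⊙ r (app t m) l = cong (app (ren r t)) (renC-++ r m l)

  renC-++ : ∀ {n m} (r : Ren n m) l l' → renC r (l ++ l') ≡ renC r l ++ renC r l'
  renC-++ r (u ∷ l) l' = cong (ren r u ∷_) (renC-++ r l l')
  renC-++ r (bnd v) l' = begin
    renC r (bnd v ++ l')                            ≡⟨ cong (renC r) (bnd-++ v l') ⟩
    bnd (ren (extR r) (v ⊙ wkC l'))                 ≡⟨ cong bnd (ren-⊙ (extR r) v (wkC l')) ⟩
    bnd (ren (extR r) v ⊙ renC (extR r) (wkC l'))   ≡⟨ cong (λ z → bnd (ren (extR r) v ⊙ z)) (renC-extR-wkC r l') ⟩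
    bnd (ren (extR r) v ⊙ wkC (renC r l'))          ≡⟨ sym (bnd-++ (ren (extR r) v) (renC r l')) ⟩
    renC r (bnd v) ++ renC r l'                     ∎
    where open ≡-Reasoning

ren-⊛ : ∀ {n m} (r : Ren n m) t l → ren r (t ⊛ l) ≡ ren r t ⊛ renC r l
ren-⊛ r t (u ∷ l) = ren-⊙ r t (u ∷ l)
ren-⊛ r t (bnd v) = refl

mutual
  ⊙-⊙ : ∀ {n} (t : Tm n) l l' → (t ⊙ l) ⊙ l' ≡ t ⊙ (l ++ l')
  ⊙-⊙ (var x)   l l' = refl
  ⊙-⊙ (lam t)   l l' = refl
  ⊙-⊙ (app t m) l l' = cong (app t) (++-assoc m l l')

  ++-assoc : ∀ {n} (l : CoTm n) l' l'' → (l ++ l') ++ l'' ≡ l ++ (l' ++ l'')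
  ++-assoc (u ∷ l) l' l'' = cong (u ∷_) (++-assoc l l' l'')
  ++-assoc (bnd v) l' l'' = begin
    (bnd v ++ l') ++ l''                 ≡⟨ cong (_++ l'') (bnd-++ v l') ⟩
    bnd (v ⊙ wkC l') ++ l''              ≡⟨ bnd-++ (v ⊙ wkC l') l'' ⟩
    bnd ((v ⊙ wkC l') ⊙ wkC l'')         ≡⟨ cong bnd (⊙-⊙ v (wkC l') (wkC l'')) ⟩
    bnd (v ⊙ (wkC l' ++ wkC l''))        ≡⟨ cong (λ z → bnd (v ⊙ z)) (sym (renC-++ suc l' l'')) ⟩
    bnd (v ⊙ wkC (l' ++ l''))            ≡⟨ sym (bnd-++ v (l' ++ l'')) ⟩
    bnd v ++ (l' ++ l'')                 ∎
    where open ≡-Reasoning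

⊛-⊙ : ∀ {n} (t : Tm n) l l' → (t ⊛ l) ⊙ l' ≡ t ⊛ (l ++ l')
⊛-⊙ t (u ∷ l) l' = ⊙-⊙ t (u ∷ l) l'
⊛-⊙ t (bnd v) l' rewrite bnd-++ v l' = refl

-- Like sub, but a variable substituted in head position is applied with _⊛_,
-- so that a π-redex created by the substitution is contracted on the spot.
mutual
  msub : ∀ {n m} → Sub n m → Tm n → Tm m
  msub ρ (var i)           = ρ i
  msub ρ (lam t)           = lam (msub (extS ρ) t)
  msub ρ (app (var i) l)   = ρ i ⊛ msubC ρ l
  msub ρ (app (lam t) l)   = app (msub ρ (lam t)) (msubC ρ l)
  msub ρ (app (app t m) l) = app (msub ρ (app t m)) (msubC ρ l)

  msubC : ∀ {n m} → Sub n m → CoTm n → CoTm m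
  msubC ρ (u ∷ l) = msub ρ u ∷ msubC ρ l
  msubC ρ (bnd v) = bnd (msub (extS ρ) v)

msub-app-bnd : ∀ {n m} (ρ : Sub n m) t v →
  msub ρ (app t (bnd v)) ≡ app (msub ρ t) (bnd (msub (extS ρ) v))
msub-app-bnd ρ (var x)   v = refl
msub-app-bnd ρ (lam t)   v = refl
msub-app-bnd ρ (app t l) v = refl

⊛-is-app : ∀ {n} (t : Tm n) l → ∃₂ λ a b → t ⊛ l ≡ app a b
⊛-is-app (var x)   (u ∷ l) = _ , _ , refl
⊛-is-app (lam t)   (u ∷ l) = _ , _ , refl
⊛-is-app (app t m) (u ∷ l) = _ , _ , refl
⊛-is-app t         (bnd v) = _ , _ , refl

msub-app-is-app : ∀ {n m} (ρ : Sub n m) t l → ∃₂ λ a b → msub ρ (app t l) ≡ app a b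
msub-app-is-app ρ (var i)   l = ⊛-is-app (ρ i) (msubC ρ l)
msub-app-is-app ρ (lam t)   l = _ , _ , refl
msub-app-is-app ρ (app t m) l = _ , _ , refl

msub-app-of-app : ∀ {n m} (ρ : Sub n m) t l → ∃₂ (λ a b → t ≡ app a b) →
  msub ρ (app t l) ≡ app (msub ρ t) (msubC ρ l)
msub-app-of-app ρ t l (_ , _ , refl) = refl

extS-extR : ∀ {n m k} {ρ : Sub m k} {q : Ren n m} {τ : Sub n k} →
  (∀ i → ρ (q i) ≡ τ i) → ∀ i → extS ρ (extR q i) ≡ extS τ i
extS-extR e zero    = refl
extS-extR e (suc i) = cong wk (e i)

mutual
  msub-ren : ∀ {n m k} {ρ : Sub m k} {q : Ren n m} {τ : Sub n k} →
    (∀ i → ρ (q i) ≡ τ i) → ∀ t → msub ρ (ren q t) ≡ msub τ t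
  msub-ren e (var i)           = e i
  msub-ren e (lam t)           = cong lam (msub-ren (extS-extR e) t)
  msub-ren e (app (var i) l)   = cong₂ _⊛_ (e i) (msubC-ren e l)
  msub-ren e (app (lam t) l)   = cong₂ app (msub-ren e (lam t)) (msubC-ren e l)
  msub-ren e (app (app t m) l) = cong₂ app (msub-ren e (app t m)) (msubC-ren e l)

  msubC-ren : ∀ {n m k} {ρ : Sub m k} {q : Ren n m} {τ : Sub n k} →
    (∀ i → ρ (q i) ≡ τ i) → ∀ l → msubC ρ (renC q l) ≡ msubC τ l
  msubC-ren e (u ∷ l) = cong₂ _∷_ (msub-ren e u) (msubC-ren e l)
  msubC-ren e (bnd v) = cong bnd (msub-ren (extS-extR e) v)

ren-extS : ∀ {n m k} {r : Ren m k} {ρ : Sub n m} {τ : Sub n k} →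
  (∀ i → ren r (ρ i) ≡ τ i) → ∀ i → ren (extR r) (extS ρ i) ≡ extS τ i
ren-extS e zero = refl
ren-extS {r = r} {ρ} e (suc i) = trans (ren-extR-wk r (ρ i)) (cong wk (e i))

mutual
  ren-msub : ∀ {n m k} {r : Ren m k} {ρ : Sub n m} {τ : Sub n k} →
    (∀ i → ren r (ρ i) ≡ τ i) → ∀ t → ren r (msub ρ t) ≡ msub τ t
  ren-msub e (var i) = e i
  ren-msub e (lam t) = cong lam (ren-msub (ren-extS e) t)
  ren-msub {r = r} {ρ} e (app (var i) l) =
    trans (ren-⊛ r (ρ i) (msubC ρ l)) (cong₂ _⊛_ (e i) (renC-msubC e l))
  ren-msub e (app (lam t) l)   = cong₂ app (ren-msub e (lam t)) (renC-msubC e l)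
  ren-msub e (app (app t m) l) = cong₂ app (ren-msub e (app t m)) (renC-msubC e l)

  renC-msubC : ∀ {n m k} {r : Ren m k} {ρ : Sub n m} {τ : Sub n k} →
    (∀ i → ren r (ρ i) ≡ τ i) → ∀ l → renC r (msubC ρ l) ≡ msubC τ l
  renC-msubC e (u ∷ l) = cong₂ _∷_ (ren-msub e u) (renC-msubC e l)
  renC-msubC e (bnd v) = cong bnd (ren-msub (ren-extS e) v)

extS-id : ∀ {n} {ρ : Sub n n} → (∀ i → ρ i ≡ var i) → ∀ i → extS ρ i ≡ var i
extS-id e zero    = refl
extS-id e (suc i) = cong wk (e i)

-- Substituting variables for variables never creates a π-redex.
mutual
  msub-id : ∀ {n} {ρ : Sub n n} → (∀ i → ρ i ≡ var i) → ∀ t → msub ρ t ≡ t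
  msub-id e (var i)           = e i
  msub-id e (lam t)           = cong lam (msub-id (extS-id e) t)
  msub-id e (app (var i) l)   = trans (cong₂ _⊛_ (e i) (msubC-id e l)) (var-⊛ i l)
  msub-id e (app (lam t) l)   = cong₂ app (msub-id e (lam t)) (msubC-id e l)
  msub-id e (app (app t m) l) = cong₂ app (msub-id e (app t m)) (msubC-id e l)

  msubC-id : ∀ {n} {ρ : Sub n n} → (∀ i → ρ i ≡ var i) → ∀ l → msubC ρ l ≡ l
  msubC-id e (u ∷ l) = cong₂ _∷_ (msub-id e u) (msubC-id e l)
  msubC-id e (bnd v) = cong bnd (msub-id (extS-id e) v)

msub-single-wk : ∀ {n} (s : Tm n) t → msub (single s) (wk t) ≡ t
msub-single-wk s t = trans (msub-ren {τ = var} (λ _ → refl) t) (msub-id (λ _ → refl) t)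

msubC-single-wkC : ∀ {n} (s : Tm n) l → msubC (single s) (wkC l) ≡ l
msubC-single-wkC s l = trans (msubC-ren {τ = var} (λ _ → refl) l) (msubC-id (λ _ → refl) l)

msub-extS-wk : ∀ {n m} (ρ : Sub n m) t → msub (extS ρ) (wk t) ≡ wk (msub ρ t)
msub-extS-wk ρ t = trans (msub-ren {τ = λ i → wk (ρ i)} (λ _ → refl) t) (sym (ren-msub (λ _ → refl) t))

msubC-extS-wkC : ∀ {n m} (ρ : Sub n m) l → msubC (extS ρ) (wkC l) ≡ wkC (msubC ρ l)
msubC-extS-wkC ρ l = trans (msubC-ren {τ = λ i → wk (ρ i)} (λ _ → refl) l) (sym (renC-msubC (λ _ → refl) l))

mutual
  msub-⊙ : ∀ {n m} (ρ : Sub n m) t u l → msub ρ (t ⊙ (u ∷ l)) ≡ msub ρ t ⊙ msubC ρ (u ∷ l)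
  msub-⊙ ρ (var x) u l = refl
  msub-⊙ ρ (lam t) u l = refl
  msub-⊙ ρ (app (var i) m) u l = begin
    ρ i ⊛ msubC ρ (m ++ (u ∷ l))              ≡⟨ cong (ρ i ⊛_) (msubC-++ ρ m u l) ⟩
    ρ i ⊛ (msubC ρ m ++ msubC ρ (u ∷ l))      ≡⟨ sym (⊛-⊙ (ρ i) (msubC ρ m) (msubC ρ (u ∷ l))) ⟩
    (ρ i ⊛ msubC ρ m) ⊙ msubC ρ (u ∷ l)       ∎
    where open ≡-Reasoning
  msub-⊙ ρ (app (lam s) m)   u l = cong (app (msub ρ (lam s))) (msubC-++ ρ m u l)
  msub-⊙ ρ (app (app s k) m) u l = cong (app (msub ρ (app s k))) (msubC-++ ρ m u l)

  msubC-++ : ∀ {n m} (ρ : Sub n m) k u l → msubC ρ (k ++ (u ∷ l)) ≡ msubC ρ k ++ msubC ρ (u ∷ l)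
  msubC-++ ρ (u' ∷ k) u l = cong (msub ρ u' ∷_) (msubC-++ ρ k u l)
  msubC-++ ρ (bnd v)  u l = begin
    msubC ρ (bnd v ++ (u ∷ l))                              ≡⟨ cong (msubC ρ) (bnd-++ v (u ∷ l)) ⟩
    bnd (msub (extS ρ) (v ⊙ (wk u ∷ wkC l)))                 ≡⟨ cong bnd (msub-⊙ (extS ρ) v (wk u) (wkC l)) ⟩
    bnd (msub (extS ρ) v ⊙ msubC (extS ρ) (wkC (u ∷ l)))     ≡⟨ cong (λ z → bnd (msub (extS ρ) v ⊙ z)) (msubC-extS-wkC ρ (u ∷ l)) ⟩
    bnd (msub (extS ρ) v ⊙ wkC (msubC ρ (u ∷ l)))            ≡⟨ sym (bnd-++ (msub (extS ρ) v) (msubC ρ (u ∷ l))) ⟩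
    msubC ρ (bnd v) ++ msubC ρ (u ∷ l)                       ∎
    where open ≡-Reasoning

msub-⊛ : ∀ {n m} (ρ : Sub n m) t l → msub ρ (t ⊛ l) ≡ msub ρ t ⊛ msubC ρ l
msub-⊛ ρ t         (u ∷ l) = msub-⊙ ρ t u l
msub-⊛ ρ (var x)   (bnd v) = refl
msub-⊛ ρ (lam t)   (bnd v) = refl
msub-⊛ ρ (app t l) (bnd v) = refl

extS-msub : ∀ {n m k} {ρ : Sub m k} {τ : Sub n m} {κ : Sub n k} →
  (∀ i → msub ρ (τ i) ≡ κ i) → ∀ i → msub (extS ρ) (extS τ i) ≡ extS κ i
extS-msub e zero = refl
extS-msub {ρ = ρ} {τ} e (suc i) = trans (msub-extS-wk ρ (τ i)) (cong wk (e i))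

mutual
  msub-msub : ∀ {n m k} {ρ : Sub m k} {τ : Sub n m} {κ : Sub n k} →
    (∀ i → msub ρ (τ i) ≡ κ i) → ∀ t → msub ρ (msub τ t) ≡ msub κ t
  msub-msub e (var i) = e i
  msub-msub e (lam t) = cong lam (msub-msub (extS-msub e) t)
  msub-msub {ρ = ρ} {τ} e (app (var i) l) =
    trans (msub-⊛ ρ (τ i) (msubC τ l)) (cong₂ _⊛_ (e i) (msubC-msubC e l))
  msub-msub e (app (lam t) l) = cong₂ app (msub-msub e (lam t)) (msubC-msubC e l)
  msub-msub {ρ = ρ} {τ} e (app (app t m) l) =
    trans (msub-app-of-app ρ (msub τ (app t m)) (msubC τ l) (msub-app-is-app τ t m))
          (cong₂ app (msub-msub e (app t m)) (msubC-msubC e l))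

  msubC-msubC : ∀ {n m k} {ρ : Sub m k} {τ : Sub n m} {κ : Sub n k} →
    (∀ i → msub ρ (τ i) ≡ κ i) → ∀ l → msubC ρ (msubC τ l) ≡ msubC κ l
  msubC-msubC e (u ∷ l) = cong₂ _∷_ (msub-msub e u) (msubC-msubC e l)
  msubC-msubC e (bnd v) = cong bnd (msub-msub (extS-msub e) v)

_∷ₛ_ : ∀ {n m} → Tm m → Sub n m → Sub (suc n) m
(t ∷ₛ ρ) zero    = t
(t ∷ₛ ρ) (suc i) = ρ i

msub-single-msub : ∀ {n m} (ρ : Sub n m) t v →
  msub (single (msub ρ t)) (msub (extS ρ) v) ≡ msub ρ (msub (single t) v)
msub-single-msub ρ t v = trans (msub-msub e₁ v) (sym (msub-msub e₂ v))
  where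
    e₁ : ∀ i → msub (single (msub ρ t)) (extS ρ i) ≡ (msub ρ t ∷ₛ ρ) i
    e₁ zero    = refl
    e₁ (suc i) = msub-single-wk (msub ρ t) (ρ i)
    e₂ : ∀ i → msub ρ (single t i) ≡ (msub ρ t ∷ₛ ρ) i
    e₂ zero    = refl
    e₂ (suc i) = refl

map-just⁻¹ : ∀ {A B : Set} {f : A → B} (x : Maybe A) {y} → map f x ≡ just y →
  ∃ λ a → x ≡ just a × y ≡ f a
map-just⁻¹ (just a) refl = a , refl , refl

zipWith-just⁻¹ : ∀ {A B C : Set} {f : A → B → C} (x : Maybe A) (y : Maybe B) {z} →
  zipWith f x y ≡ just z → ∃₂ λ a b → x ≡ just a × y ≡ just b × z ≡ f a b
zipWith-just⁻¹ (just a) (just b) refl = a , b , refl , refl , refl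

PRen : ℕ → ℕ → Set
PRen m n = Fin m → Maybe (Fin n)

extP : ∀ {m n} → PRen m n → PRen (suc m) (suc n)
extP p zero    = just zero
extP p (suc i) = map suc (p i)

mutual
  strengthen : ∀ {m n} → PRen m n → Tm m → Maybe (Tm n)
  strengthen p (var i)   = map var (p i)
  strengthen p (lam t)   = map lam (strengthen (extP p) t)
  strengthen p (app t l) = zipWith app (strengthen p t) (strengthenC p l)

  strengthenC : ∀ {m n} → PRen m n → CoTm m → Maybe (CoTm n)
  strengthenC p (u ∷ l) = zipWith _∷_ (strengthen p u) (strengthenC p l)
  strengthenC p (bnd v) = map bnd (strengthen (extP p) v)

_Inverts_ : ∀ {m n} → PRen m n → Ren n m → Set
p Inverts r = (∀ j → p (r j) ≡ just j) × (∀ i j → p i ≡ just j → i ≡ r j)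

extP-inverts : ∀ {m n} {p : PRen m n} {r} → p Inverts r → extP p Inverts extR r
extP-inverts {p = p} {r} (left , right) = left′ , right′
  where
    left′ : ∀ j → extP p (extR r j) ≡ just j
    left′ zero = refl
    left′ (suc j) rewrite left j = refl
    right′ : ∀ i j → extP p i ≡ just j → i ≡ extR r j
    right′ zero .zero refl = refl
    right′ (suc i) j e with map-just⁻¹ (p i) e
    ... | a , e′ , refl = cong suc (right i a e′)

mutual
  strengthen-ren : ∀ {m n} {p : PRen m n} {r} → p Inverts r → ∀ t → strengthen p (ren r t) ≡ just t
  strengthen-ren (left , _) (var i) rewrite left i = refl
  strengthen-ren inv (lam t) rewrite strengthen-ren (extP-inverts inv) t = refl
  strengthen-ren inv (app t l) rewrite strengthen-ren inv t | strengthenC-renC inv l = refl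

  strengthenC-renC : ∀ {m n} {p : PRen m n} {r} → p Inverts r → ∀ l → strengthenC p (renC r l) ≡ just l
  strengthenC-renC inv (u ∷ l) rewrite strengthen-ren inv u | strengthenC-renC inv l = refl
  strengthenC-renC inv (bnd v) rewrite strengthen-ren (extP-inverts inv) v = refl

mutual
  strengthen-just : ∀ {m n} {p : PRen m n} {r} → p Inverts r → ∀ t {t'} →
    strengthen p t ≡ just t' → t ≡ ren r t'
  strengthen-just {p = p} (_ , right) (var i) e with map-just⁻¹ (p i) e
  ... | j , e′ , refl = cong var (right i j e′)
  strengthen-just {p = p} inv (lam t) e with map-just⁻¹ (strengthen (extP p) t) e
  ... | t' , e′ , refl = cong lam (strengthen-just (extP-inverts inv) t e′)
  strengthen-just {p = p} inv (app t l) e with zipWith-just⁻¹ (strengthen p t) (strengthenC p l) e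
  ... | t' , l' , e₁ , e₂ , refl = cong₂ app (strengthen-just inv t e₁) (strengthenC-just inv l e₂)

  strengthenC-just : ∀ {m n} {p : PRen m n} {r} → p Inverts r → ∀ l {l'} →
    strengthenC p l ≡ just l' → l ≡ renC r l'
  strengthenC-just {p = p} inv (u ∷ l) e with zipWith-just⁻¹ (strengthen p u) (strengthenC p l) e
  ... | u' , l' , e₁ , e₂ , refl = cong₂ _∷_ (strengthen-just inv u e₁) (strengthenC-just inv l e₂)
  strengthenC-just {p = p} inv (bnd v) e with map-just⁻¹ (strengthen (extP p) v) e
  ... | v' , e′ , refl = cong bnd (strengthen-just (extP-inverts inv) v e′)

unshift : ∀ {n} → PRen (suc n) n
unshift zero    = nothing
unshift (suc j) = just j

unshift-inverts-suc : ∀ {n} → unshift {n} Inverts suc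
unshift-inverts-suc = (λ _ → refl) , λ { (suc i) .i refl → refl }

-- A binder (x)v is a μ-redex iff μ-body v = just l, and it then contracts to l.
μ-body : ∀ {n} → Tm (suc n) → Maybe (CoTm n)
μ-body (app (var zero) l) = strengthenC unshift l
μ-body _                  = nothing

μ-body-just : ∀ {n} (v : Tm (suc n)) {l} → μ-body v ≡ just l → v ≡ app (var zero) (wkC l)
μ-body-just (app (var zero) l) e = cong (app (var zero)) (strengthenC-just unshift-inverts-suc l e)

μ-body-wkC : ∀ {n} (l : CoTm n) → μ-body (app (var zero) (wkC l)) ≡ just l
μ-body-wkC = strengthenC-renC unshift-inverts-suc

bndμ : ∀ {n} → Tm (suc n) → CoTm n
bndμ v with μ-body v
... | just l  = l
... | nothing = bnd v

bndμ-cases : ∀ {n} (v : Tm (suc n)) →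
  (∃ λ l → v ≡ app (var zero) (wkC l) × bndμ v ≡ l) ⊎ (bndμ v ≡ bnd v)
bndμ-cases v with μ-body v in eq
... | just l  = inj₁ (l , μ-body-just v eq , refl)
... | nothing = inj₂ refl

bndμ-μ : ∀ {n} (l : CoTm n) → bndμ (app (var zero) (wkC l)) ≡ l
bndμ-μ l rewrite μ-body-wkC l = refl

-- Parallel reduction on π-normal forms

infix 4 _⇛_ _⇛ᶜ_

-- Applications are rebuilt with _⊛_ and σ-contractions use msub: the
-- π-redexes such a step would create are contracted at once.
mutual
  data _⇛_ {n : ℕ} : Tm n → Tm n → Set where
    pvar : ∀ {i} → var i ⇛ var i
    plam : ∀ {t t'} → t ⇛ t' → lam t ⇛ lam t'
    papp : ∀ {t t' l l'} → t ⇛ t' → l ⇛ᶜ l' → app t l ⇛ t' ⊛ l'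
    pσ   : ∀ {t t' v v'} → t ⇛ t' → v ⇛ v' → app t (bnd v) ⇛ msub (single t') v'
    pβ   : ∀ {t t' u u' l l'} → t ⇛ t' → u ⇛ u' → l ⇛ᶜ l' →
           app (lam t) (u ∷ l) ⇛ app u' (bnd (t' ⊛ wkC l'))

  data _⇛ᶜ_ {n : ℕ} : CoTm n → CoTm n → Set where
    pcons : ∀ {u u' l l'} → u ⇛ u' → l ⇛ᶜ l' → u ∷ l ⇛ᶜ u' ∷ l'
    pbnd  : ∀ {v v'} → v ⇛ v' → bnd v ⇛ᶜ bnd v'
    pμ    : ∀ {v l'} → v ⇛ app (var zero) (wkC l') → bnd v ⇛ᶜ l'

⇛-≡ : ∀ {n} {t t' t'' : Tm n} → t' ≡ t'' → t ⇛ t' → t ⇛ t''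
⇛-≡ refl d = d

ren-single : ∀ {n m} (r : Ren n m) t i → ren r (single t i) ≡ single (ren r t) (extR r i)
ren-single r t zero    = refl
ren-single r t (suc i) = refl

ren-msub-single : ∀ {n m} (r : Ren n m) t v →
  ren r (msub (single t) v) ≡ msub (single (ren r t)) (ren (extR r) v)
ren-msub-single r t v =
  trans (ren-msub (λ _ → refl) v) (sym (msub-ren (λ i → sym (ren-single r t i)) v))

ren-⊛-wkC : ∀ {n m} (r : Ren n m) t l → ren (extR r) (t ⊛ wkC l) ≡ ren (extR r) t ⊛ wkC (renC r l)
ren-⊛-wkC r t l = trans (ren-⊛ (extR r) t (wkC l)) (cong (ren (extR r) t ⊛_) (renC-extR-wkC r l))

mutual
  ren⇛ : ∀ {n m} (r : Ren n m) {t t'} → t ⇛ t' → ren r t ⇛ ren r t'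
  ren⇛ r pvar     = pvar
  ren⇛ r (plam d) = plam (ren⇛ (extR r) d)
  ren⇛ r (papp {t' = t'} {l' = l'} d e) =
    ⇛-≡ (sym (ren-⊛ r t' l')) (papp (ren⇛ r d) (renC⇛ r e))
  ren⇛ r (pσ {t' = t'} {v' = v'} d e) =
    ⇛-≡ (sym (ren-msub-single r t' v')) (pσ (ren⇛ r d) (ren⇛ (extR r) e))
  ren⇛ r (pβ {t' = t'} {u' = u'} {l' = l'} d e f) =
    ⇛-≡ (cong (λ z → app (ren r u') (bnd z)) (sym (ren-⊛-wkC r t' l')))
        (pβ (ren⇛ (extR r) d) (ren⇛ r e) (renC⇛ r f))

  renC⇛ : ∀ {n m} (r : Ren n m) {l l'} → l ⇛ᶜ l' → renC r l ⇛ᶜ renC r l'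
  renC⇛ r (pcons d e) = pcons (ren⇛ r d) (renC⇛ r e)
  renC⇛ r (pbnd d)    = pbnd (ren⇛ (extR r) d)
  renC⇛ r (pμ {l' = l'} d) =
    pμ (⇛-≡ (cong (app (var zero)) (renC-extR-wkC r l')) (ren⇛ (extR r) d))

mutual
  ⊙⇛ : ∀ {n} {t t' : Tm n} {u l l'} → t ⇛ t' → u ∷ l ⇛ᶜ l' → t ⊙ (u ∷ l) ⇛ t' ⊙ l'
  ⊙⇛ pvar     e@(pcons _ _) = papp pvar e
  ⊙⇛ (plam d) e@(pcons _ _) = papp (plam d) e
  ⊙⇛ (papp {t' = s'} {l' = m'} d₁ d₂) e@(pcons {u' = u'} {l' = l'} _ _) =
    ⇛-≡ (sym (⊛-⊙ s' m' (u' ∷ l'))) (papp d₁ (++⇛ d₂ e))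
  ⊙⇛ {u = u} {l} (pσ {t = s} {t' = s'} {v = w} {v' = w'} d₁ d₂) e@(pcons {u' = u'} {l' = l'} _ _) =
    subst (λ z → app s z ⇛ msub (single s') w' ⊙ (u' ∷ l')) (sym (bnd-++ w (u ∷ l)))
      (⇛-≡ eq (pσ d₁ (⊙⇛ d₂ (renC⇛ suc e))))
    where
      eq : msub (single s') (w' ⊙ (wk u' ∷ wkC l')) ≡ msub (single s') w' ⊙ (u' ∷ l')
      eq = trans (msub-⊙ (single s') w' (wk u') (wkC l'))
                 (cong (msub (single s') w' ⊙_) (msubC-single-wkC s' (u' ∷ l')))
  ⊙⇛ (pβ {t' = s'} {u' = w'} {l' = m'} d₁ d₂ d₃) e@(pcons {u' = u'} {l' = l'} _ _) =
    ⇛-≡ eq (pβ d₁ d₂ (++⇛ d₃ e))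
    where
      open ≡-Reasoning
      eq : app w' (bnd (s' ⊛ wkC (m' ++ (u' ∷ l')))) ≡ app w' (bnd (s' ⊛ wkC m')) ⊙ (u' ∷ l')
      eq = cong (app w') (sym (begin
        bnd (s' ⊛ wkC m') ++ (u' ∷ l')            ≡⟨ bnd-++ (s' ⊛ wkC m') (u' ∷ l') ⟩
        bnd ((s' ⊛ wkC m') ⊙ wkC (u' ∷ l'))       ≡⟨ cong bnd (⊛-⊙ s' (wkC m') (wkC (u' ∷ l'))) ⟩
        bnd (s' ⊛ (wkC m' ++ wkC (u' ∷ l')))      ≡⟨ cong (λ z → bnd (s' ⊛ z)) (sym (renC-++ suc m' (u' ∷ l'))) ⟩
        bnd (s' ⊛ wkC (m' ++ (u' ∷ l')))          ∎))

  ++⇛ : ∀ {n} {m m' : CoTm n} {u l l'} → m ⇛ᶜ m' → u ∷ l ⇛ᶜ l' → m ++ (u ∷ l) ⇛ᶜ m' ++ l'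
  ++⇛ (pcons d₁ d₂) e = pcons d₁ (++⇛ d₂ e)
  ++⇛ {u = u} {l} (pbnd {v = v} {v' = v'} d) e@(pcons {u' = u'} {l' = l'} _ _)
    rewrite bnd-++ v (u ∷ l) | bnd-++ v' (u' ∷ l') = pbnd (⊙⇛ d (renC⇛ suc e))
  ++⇛ {u = u} {l} (pμ {v = v} {l' = k'} d) e@(pcons {u' = u'} {l' = l'} _ _)
    rewrite bnd-++ v (u ∷ l) =
    pμ (⇛-≡ (cong (app (var zero)) (sym (renC-++ suc k' (u' ∷ l')))) (⊙⇛ d (renC⇛ suc e)))

⊛⇛ : ∀ {n} {t t' : Tm n} {l l'} → t ⇛ t' → l ⇛ᶜ l' → t ⊛ l ⇛ t' ⊛ l'
⊛⇛ d e@(pcons _ _) = ⊙⇛ d e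
⊛⇛ d e@(pbnd _)    = papp d e
⊛⇛ d e@(pμ _)      = papp d e

extS⇛ : ∀ {n m} {ρ ρ' : Sub n m} → (∀ i → ρ i ⇛ ρ' i) → ∀ i → extS ρ i ⇛ extS ρ' i
extS⇛ h zero    = pvar
extS⇛ h (suc i) = ren⇛ suc (h i)

msub-⊛-wkC : ∀ {n m} (ρ : Sub n m) t l →
  msub (extS ρ) (t ⊛ wkC l) ≡ msub (extS ρ) t ⊛ wkC (msubC ρ l)
msub-⊛-wkC ρ t l = trans (msub-⊛ (extS ρ) t (wkC l)) (cong (msub (extS ρ) t ⊛_) (msubC-extS-wkC ρ l))

mutual
  msub⇛ : ∀ {n m} {ρ ρ' : Sub n m} → (∀ i → ρ i ⇛ ρ' i) → ∀ {t t'} → t ⇛ t' → msub ρ t ⇛ msub ρ' t'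
  msub⇛ h (pvar {i}) = h i
  msub⇛ h (plam d)   = plam (msub⇛ (extS⇛ h) d)
  msub⇛ {ρ' = ρ'} h (papp {l' = l'} (pvar {i}) e) =
    ⇛-≡ (sym (msub-⊛ ρ' (var i) l')) (⊛⇛ (h i) (msubC⇛ h e))
  msub⇛ {ρ' = ρ'} h (papp {t' = t'} {l' = l'} (plam d) e) =
    ⇛-≡ (sym (msub-⊛ ρ' t' l')) (papp (plam (msub⇛ (extS⇛ h) d)) (msubC⇛ h e))
  msub⇛ {ρ' = ρ'} h (papp {t = app _ _} {t' = t'} {l' = l'} d e) =
    ⇛-≡ (sym (msub-⊛ ρ' t' l')) (papp (msub⇛ h d) (msubC⇛ h e))
  msub⇛ {ρ = ρ} {ρ'} h (pσ {t = t} {t' = t'} {v = v} {v' = v'} d e) =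
    subst (_⇛ msub ρ' (msub (single t') v')) (sym (msub-app-bnd ρ t v))
      (⇛-≡ (msub-single-msub ρ' t' v') (pσ (msub⇛ h d) (msub⇛ (extS⇛ h) e)))
  msub⇛ {ρ' = ρ'} h (pβ {t' = s'} {u' = u'} {l' = l'} d e f) =
    ⇛-≡ (sym (trans (msub-app-bnd ρ' u' (s' ⊛ wkC l'))
                    (cong (λ z → app (msub ρ' u') (bnd z)) (msub-⊛-wkC ρ' s' l'))))
        (pβ (msub⇛ (extS⇛ h) d) (msub⇛ h e) (msubC⇛ h f))

  msubC⇛ : ∀ {n m} {ρ ρ' : Sub n m} → (∀ i → ρ i ⇛ ρ' i) → ∀ {l l'} → l ⇛ᶜ l' → msubC ρ l ⇛ᶜ msubC ρ' l'
  msubC⇛ h (pcons d e) = pcons (msub⇛ h d) (msubC⇛ h e)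
  msubC⇛ h (pbnd d)    = pbnd (msub⇛ (extS⇛ h) d)
  msubC⇛ {ρ' = ρ'} h (pμ {l' = l'} d) =
    pμ (⇛-≡ (trans (var-⊛ zero (msubC (extS ρ') (wkC l'))) (cong (app (var zero)) (msubC-extS-wkC ρ' l')))
            (msub⇛ (extS⇛ h) d))

IsPullback : ∀ {a b c d} → Ren a c → Ren b c → Ren d a → Ren d b → Set
IsPullback f g h k = ∀ i j → f i ≡ g j → ∃ λ x → i ≡ h x × j ≡ k x

IsPullback-extR : ∀ {a b c d} {f : Ren a c} {g : Ren b c} {h : Ren d a} {k : Ren d b} →
  IsPullback f g h k → IsPullback (extR f) (extR g) (extR h) (extR k)
IsPullback-extR pb zero    zero    e = zero , refl , refl
IsPullback-extR pb (suc i) (suc j) e with pb i j (suc-injective e)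
... | x , refl , refl = suc x , refl , refl

mutual
  ren-pullback : ∀ {a b c d} {f : Ren a c} {g : Ren b c} {h : Ren d a} {k : Ren d b} →
    IsPullback f g h k → ∀ t u → ren f t ≡ ren g u → ∃ λ s → t ≡ ren h s × u ≡ ren k s
  ren-pullback pb (var i) (var j) e with pb i j (var-injective e)
  ... | x , refl , refl = var x , refl , refl
  ren-pullback pb (lam t) (lam u) e with ren-pullback (IsPullback-extR pb) t u (lam-injective e)
  ... | s , refl , refl = lam s , refl , refl
  ren-pullback pb (app t l) (app u m) e
    with ren-pullback pb t u (app-injectiveˡ e) | renC-pullback pb l m (app-injectiveʳ e)
  ... | s , refl , refl | k , refl , refl = app s k , refl , refl

  renC-pullback : ∀ {a b c d} {f : Ren a c} {g : Ren b c} {h : Ren d a} {k : Ren d b} →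
    IsPullback f g h k → ∀ l m → renC f l ≡ renC g m → ∃ λ s → l ≡ renC h s × m ≡ renC k s
  renC-pullback pb (t ∷ l) (u ∷ m) e
    with ren-pullback pb t u (∷-injectiveˡ e) | renC-pullback pb l m (∷-injectiveʳ e)
  ... | s , refl , refl | k , refl , refl = s ∷ k , refl , refl
  renC-pullback pb (bnd v) (bnd w) e with ren-pullback (IsPullback-extR pb) v w (bnd-injective e)
  ... | s , refl , refl = bnd s , refl , refl

extR-suc-pullback : ∀ {n m} (r : Ren n m) → IsPullback (extR r) suc suc r
extR-suc-pullback r (suc i) j e = i , refl , sym (suc-injective e)

renC-extR≡wkC : ∀ {n m} (r : Ren n m) l k → renC (extR r) l ≡ wkC k →
  ∃ λ s → l ≡ wkC s × k ≡ renC r s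
renC-extR≡wkC r = renC-pullback (extR-suc-pullback r)

ren-extR≡μ-body : ∀ {n m} (r : Ren n m) v k → app (var zero) (wkC k) ≡ ren (extR r) v →
  ∃ λ s → v ≡ app (var zero) (wkC s) × k ≡ renC r s
ren-extR≡μ-body r (app (var zero) l) k e with renC-extR≡wkC r l k (sym (app-injectiveʳ e))
... | s , refl , refl = s , refl , refl
ren-extR≡μ-body r (app (var (suc i)) l) k e with var-injective (app-injectiveˡ e)
... | ()

mutual
  ren⇛⁻¹ : ∀ {n m} (r : Ren n m) t {t''} → ren r t ⇛ t'' → ∃ λ t' → t ⇛ t' × t'' ≡ ren r t'
  ren⇛⁻¹ r (var i) pvar = var i , pvar , refl
  ren⇛⁻¹ r (lam t) (plam d) with ren⇛⁻¹ (extR r) t d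
  ... | t' , d' , refl = lam t' , plam d' , refl
  ren⇛⁻¹ r (app t (bnd v))         (papp d e) = ren⇛⁻¹-papp r t (bnd v) d e
  ren⇛⁻¹ r (app (var i) (u ∷ l))   (papp d e) = ren⇛⁻¹-papp r (var i) (u ∷ l) d e
  ren⇛⁻¹ r (app (lam t) (u ∷ l))   (papp d e) = ren⇛⁻¹-papp r (lam t) (u ∷ l) d e
  ren⇛⁻¹ r (app (app t m) (u ∷ l)) (papp d e) = ren⇛⁻¹-papp r (app t m) (u ∷ l) d e
  ren⇛⁻¹ r (app t (bnd v)) (pσ d e) with ren⇛⁻¹ r t d | ren⇛⁻¹ (extR r) v e
  ... | t' , d' , refl | v' , e' , refl =
    msub (single t') v' , pσ d' e' , sym (ren-msub-single r t' v')
  ren⇛⁻¹ r (app (lam t) (u ∷ l)) (pβ d e f) with ren⇛⁻¹ (extR r) t d | ren⇛⁻¹ r u e | renC⇛⁻¹ r l f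
  ... | t' , d' , refl | u' , e' , refl | l' , f' , refl =
    app u' (bnd (t' ⊛ wkC l')) , pβ d' e' f' ,
    cong (λ z → app (ren r u') (bnd z)) (sym (ren-⊛-wkC r t' l'))

  ren⇛⁻¹-papp : ∀ {n m} (r : Ren n m) t l {t'' l''} → ren r t ⇛ t'' → renC r l ⇛ᶜ l'' →
    ∃ λ t' → app t l ⇛ t' × t'' ⊛ l'' ≡ ren r t'
  ren⇛⁻¹-papp r t l d e with ren⇛⁻¹ r t d | renC⇛⁻¹ r l e
  ... | t' , d' , refl | l' , e' , refl = t' ⊛ l' , papp d' e' , sym (ren-⊛ r t' l')

  renC⇛⁻¹ : ∀ {n m} (r : Ren n m) l {l''} → renC r l ⇛ᶜ l'' → ∃ λ l' → l ⇛ᶜ l' × l'' ≡ renC r l'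
  renC⇛⁻¹ r (u ∷ l) (pcons d e) with ren⇛⁻¹ r u d | renC⇛⁻¹ r l e
  ... | u' , d' , refl | l' , e' , refl = u' ∷ l' , pcons d' e' , refl
  renC⇛⁻¹ r (bnd v) (pbnd d) with ren⇛⁻¹ (extR r) v d
  ... | v' , d' , refl = bnd v' , pbnd d' , refl
  renC⇛⁻¹ r (bnd v) (pμ {l' = k} d) with ren⇛⁻¹ (extR r) v d
  ... | v' , d' , e with ren-extR≡μ-body r v' k e
  ...   | s , refl , refl = s , pμ d' , refl

-- Complete development

msub-single-zero-ren-extR-suc : ∀ {n} (v : Tm (suc n)) → msub (single (var zero)) (ren (extR suc) v) ≡ v
msub-single-zero-ren-extR-suc v = trans (msub-ren {τ = var} contract v) (msub-id (λ _ → refl) v)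
  where
    contract : ∀ {n} (i : Fin (suc n)) → single (var zero) (extR suc i) ≡ var i
    contract zero    = refl
    contract (suc i) = refl

bnd⇛bndμ : ∀ {n} {v v' : Tm (suc n)} → v ⇛ v' → bnd v ⇛ᶜ bndμ v'
bnd⇛bndμ {v' = v'} d with bndμ-cases v'
... | inj₁ (l , is-μ , bndμ≡l) rewrite bndμ≡l = pμ (⇛-≡ is-μ d)
... | inj₂ bndμ≡bnd rewrite bndμ≡bnd = pbnd d

-- A μ-redex body only reduces by reducing its co-term, or, when that co-term is
-- a binder (y)w, by a σ-step back to w itself.
μ-body⇛bndμ : ∀ {n} (l : CoTm n) {v'} → app (var zero) (wkC l) ⇛ v' → l ⇛ᶜ bndμ v'
μ-body⇛bndμ (u ∷ l) (papp pvar e) with renC⇛⁻¹ suc (u ∷ l) e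
... | l' , e' , refl rewrite var-⊛ zero (wkC l') | bndμ-μ l' = e'
μ-body⇛bndμ (bnd w) (papp pvar e) with renC⇛⁻¹ suc (bnd w) e
... | l' , e' , refl rewrite var-⊛ zero (wkC l') | bndμ-μ l' = e'
μ-body⇛bndμ (bnd w) (pσ pvar e) with ren⇛⁻¹ (extR suc) w e
... | w' , e' , refl rewrite msub-single-zero-ren-extR-suc w' = bnd⇛bndμ e'

⊛⇛msub-μ-body : ∀ {n} (l : CoTm n) {v' t t'} → app (var zero) (wkC l) ⇛ v' → t ⇛ t' →
  t ⊛ l ⇛ msub (single t') v'
⊛⇛msub-μ-body (u ∷ l) {t' = t'} (papp pvar e) d with renC⇛⁻¹ suc (u ∷ l) e
... | l' , e' , refl =
  ⇛-≡ (sym (trans (msub-⊛ (single t') (var zero) (wkC l')) (cong (t' ⊛_) (msubC-single-wkC t' l'))))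
      (⊛⇛ d e')
⊛⇛msub-μ-body (bnd w) {t' = t'} (papp pvar e) d with renC⇛⁻¹ suc (bnd w) e
... | l' , e' , refl =
  ⇛-≡ (sym (trans (msub-⊛ (single t') (var zero) (wkC l')) (cong (t' ⊛_) (msubC-single-wkC t' l'))))
      (⊛⇛ d e')
⊛⇛msub-μ-body (bnd w) (pσ pvar e) d with ren⇛⁻¹ (extR suc) w e
... | w' , e' , refl rewrite msub-single-zero-ren-extR-suc w' = pσ d e'

mutual
  dev : ∀ {n} → Tm n → Tm n
  dev (var i)                 = var i
  dev (lam t)                 = lam (dev t)
  dev (app t (bnd v))         = msub (single (dev t)) (dev v)
  dev (app (lam t) (u ∷ l))   = app (dev u) (bnd (dev t ⊛ wkC (devC l)))
  dev (app (var i) (u ∷ l))   = var i ⊛ (dev u ∷ devC l)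
  dev (app (app t m) (u ∷ l)) = dev (app t m) ⊛ (dev u ∷ devC l)

  devC : ∀ {n} → CoTm n → CoTm n
  devC (u ∷ l) = dev u ∷ devC l
  devC (bnd v) = bndμ (dev v)

single⇛ : ∀ {n} {t t' : Tm n} → t ⇛ t' → ∀ i → single t i ⇛ single t' i
single⇛ d zero    = d
single⇛ d (suc i) = pvar

mutual
  ⇛-dev : ∀ {n} {t t' : Tm n} → t ⇛ t' → t' ⇛ dev t
  ⇛-dev pvar                             = pvar
  ⇛-dev (plam d)                         = plam (⇛-dev d)
  ⇛-dev (papp d (pbnd e))                = pσ (⇛-dev d) (⇛-dev e)
  ⇛-dev (papp d (pμ {l' = l'} e))        = ⊛⇛msub-μ-body l' (⇛-dev e) (⇛-dev d)
  ⇛-dev (papp (plam d) (pcons e f))      = pβ (⇛-dev d) (⇛-dev e) (⇛ᶜ-devC f)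
  ⇛-dev (papp pvar (pcons e f))          = ⊛⇛ pvar (pcons (⇛-dev e) (⇛ᶜ-devC f))
  ⇛-dev (papp {t = app _ _} d (pcons e f)) = ⊛⇛ (⇛-dev d) (pcons (⇛-dev e) (⇛ᶜ-devC f))
  ⇛-dev (pσ d e)                         = msub⇛ (single⇛ (⇛-dev d)) (⇛-dev e)
  ⇛-dev (pβ d e f)                       = papp (⇛-dev e) (pbnd (⊛⇛ (⇛-dev d) (renC⇛ suc (⇛ᶜ-devC f))))

  ⇛ᶜ-devC : ∀ {n} {l l' : CoTm n} → l ⇛ᶜ l' → l' ⇛ᶜ devC l
  ⇛ᶜ-devC (pcons d e) = pcons (⇛-dev d) (⇛ᶜ-devC e)
  ⇛ᶜ-devC (pbnd d)    = bnd⇛bndμ (⇛-dev d)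
  ⇛ᶜ-devC (pμ {l' = l'} d) = μ-body⇛bndμ l' (⇛-dev d)

module _ {a ℓ} {A : Set a} {_⇒_ : Rel A ℓ} (f : A → A) (triangle : ∀ {x y} → x ⇒ y → y ⇒ f x) where

  triangle-strip : ∀ {x y z} → x ⇒ y → Star _⇒_ x z → ∃ λ w → Star _⇒_ y w × z ⇒ w
  triangle-strip {y = y} s ε = y , ε , s
  triangle-strip s (s′ ◅ ss) with triangle-strip (triangle s′) ss
  ... | w , y⇒*w , z⇒w = w , triangle s ◅ y⇒*w , z⇒w

  triangle⇒confluent : Rewriting.Confluent _⇒_
  triangle⇒confluent {C = z} ε ss = z , ss , ε
  triangle⇒confluent (s ◅ ss) ss′ with triangle-strip s ss′
  ... | w , y⇒*w , z⇒w with triangle⇒confluent ss y⇒*w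
  ...   | v , x⇒*v , w⇒*v = v , x⇒*v , z⇒w ◅ w⇒*v

-- π-normal forms

mutual
  πnf : ∀ {n} → Tm n → Tm n
  πnf (var i)   = var i
  πnf (lam t)   = lam (πnf t)
  πnf (app t l) = πnf t ⊛ πnfC l

  πnfC : ∀ {n} → CoTm n → CoTm n
  πnfC (u ∷ l) = πnf u ∷ πnfC l
  πnfC (bnd v) = bnd (πnf v)

mutual
  πnf-ren : ∀ {n m} (r : Ren n m) t → πnf (ren r t) ≡ ren r (πnf t)
  πnf-ren r (var i)   = refl
  πnf-ren r (lam t)   = cong lam (πnf-ren (extR r) t)
  πnf-ren r (app t l) = trans (cong₂ _⊛_ (πnf-ren r t) (πnfC-renC r l)) (sym (ren-⊛ r (πnf t) (πnfC l)))

  πnfC-renC : ∀ {n m} (r : Ren n m) l → πnfC (renC r l) ≡ renC r (πnfC l)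
  πnfC-renC r (u ∷ l) = cong₂ _∷_ (πnf-ren r u) (πnfC-renC r l)
  πnfC-renC r (bnd v) = cong bnd (πnf-ren (extR r) v)

πnf-extS : ∀ {n m} {ρ : Sub n m} {τ : Sub n m} → (∀ i → πnf (ρ i) ≡ τ i) → ∀ i → πnf (extS ρ i) ≡ extS τ i
πnf-extS e zero = refl
πnf-extS {ρ = ρ} e (suc i) = trans (πnf-ren suc (ρ i)) (cong wk (e i))

mutual
  πnf-sub : ∀ {n m} {ρ : Sub n m} {τ : Sub n m} → (∀ i → πnf (ρ i) ≡ τ i) → ∀ t →
    πnf (sub ρ t) ≡ msub τ (πnf t)
  πnf-sub e (var i)   = e i
  πnf-sub e (lam t)   = cong lam (πnf-sub (πnf-extS e) t)
  πnf-sub {τ = τ} e (app t l) =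
    trans (cong₂ _⊛_ (πnf-sub e t) (πnfC-subC e l)) (sym (msub-⊛ τ (πnf t) (πnfC l)))

  πnfC-subC : ∀ {n m} {ρ : Sub n m} {τ : Sub n m} → (∀ i → πnf (ρ i) ≡ τ i) → ∀ l →
    πnfC (subC ρ l) ≡ msubC τ (πnfC l)
  πnfC-subC e (u ∷ l) = cong₂ _∷_ (πnf-sub e u) (πnfC-subC e l)
  πnfC-subC e (bnd v) = cong bnd (πnf-sub (πnf-extS e) v)

mutual
  πnf-⊙ : ∀ {n} (t : Tm n) u l → πnf (t ⊙ (u ∷ l)) ≡ πnf t ⊙ πnfC (u ∷ l)
  πnf-⊙ (var i)   u l = refl
  πnf-⊙ (lam t)   u l = refl
  πnf-⊙ (app t m) u l =
    trans (cong (πnf t ⊛_) (πnfC-++ m u l)) (sym (⊛-⊙ (πnf t) (πnfC m) (πnfC (u ∷ l))))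

  πnfC-++ : ∀ {n} (m : CoTm n) u l → πnfC (m ++ (u ∷ l)) ≡ πnfC m ++ πnfC (u ∷ l)
  πnfC-++ (u' ∷ m) u l = cong (πnf u' ∷_) (πnfC-++ m u l)
  πnfC-++ (bnd v)  u l rewrite bnd-++ v (u ∷ l) | bnd-++ (πnf v) (πnfC (u ∷ l)) =
    cong bnd (trans (πnf-⊙ v (wk u) (wkC l)) (cong (πnf v ⊙_) (πnfC-renC suc (u ∷ l))))

mutual
  πnf⇛πnf : ∀ {n} (t : Tm n) → πnf t ⇛ πnf t
  πnf⇛πnf (var i)   = pvar
  πnf⇛πnf (lam t)   = plam (πnf⇛πnf t)
  πnf⇛πnf (app t l) = ⊛⇛ (πnf⇛πnf t) (πnfC⇛πnfC l)

  πnfC⇛πnfC : ∀ {n} (l : CoTm n) → πnfC l ⇛ᶜ πnfC l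
  πnfC⇛πnfC (u ∷ l) = pcons (πnf⇛πnf u) (πnfC⇛πnfC l)
  πnfC⇛πnfC (bnd v) = pbnd (πnf⇛πnf v)

-- A π-step disappears under πnf; every other step becomes a parallel step.
mutual
  ⟶⇒πnf⇛ : ∀ {n} {t t' : Tm n} → t ⟶ t' → πnf t ⇛ πnf t'
  ⟶⇒πnf⇛ (β {t = t} {u} {l}) =
    ⇛-≡ (cong (λ z → app (πnf u) (bnd (πnf t ⊛ z))) (sym (πnfC-renC suc l)))
        (pβ (πnf⇛πnf t) (πnf⇛πnf u) (πnfC⇛πnfC l))
  ⟶⇒πnf⇛ (σ {t = t} {v}) = ⇛-≡ (sym (πnf-sub πnf-single v)) (pσ (πnf⇛πnf t) (πnf⇛πnf v))
    where
      πnf-single : ∀ i → πnf (single t i) ≡ single (πnf t) i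
      πnf-single zero    = refl
      πnf-single (suc i) = refl
  ⟶⇒πnf⇛ (π {t = t} {l} {u} {l'}) =
    ⇛-≡ (trans (⊛-⊙ (πnf t) (πnfC l) (πnfC (u ∷ l'))) (cong (πnf t ⊛_) (sym (πnfC-++ l u l'))))
        (πnf⇛πnf (app (app t l) (u ∷ l')))
  ⟶⇒πnf⇛ (ξλ s)         = plam (⟶⇒πnf⇛ s)
  ⟶⇒πnf⇛ (ξ₁ {l = l} s) = ⊛⇛ (⟶⇒πnf⇛ s) (πnfC⇛πnfC l)
  ⟶⇒πnf⇛ (ξ₂ {t = t} s) = ⊛⇛ (πnf⇛πnf t) (⟶ᶜ⇒πnfC⇛ᶜ s)

  ⟶ᶜ⇒πnfC⇛ᶜ : ∀ {n} {l l' : CoTm n} → l ⟶ᶜ l' → πnfC l ⇛ᶜ πnfC l'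
  ⟶ᶜ⇒πnfC⇛ᶜ (μ {l = l}) =
    pμ (⇛-≡ (trans (var-⊛ zero (πnfC (wkC l))) (cong (app (var zero)) (πnfC-renC suc l)))
            (πnf⇛πnf (app (var zero) (wkC l))))
  ⟶ᶜ⇒πnfC⇛ᶜ (ξ∷₁ {l = l} s) = pcons (⟶⇒πnf⇛ s) (πnfC⇛πnfC l)
  ⟶ᶜ⇒πnfC⇛ᶜ (ξ∷₂ {u = u} s) = pcons (πnf⇛πnf u) (⟶ᶜ⇒πnfC⇛ᶜ s)
  ⟶ᶜ⇒πnfC⇛ᶜ (ξbnd s)        = pbnd (⟶⇒πnf⇛ s)

_⟶ᶜ*_ : ∀ {n} → CoTm n → CoTm n → Set
_⟶ᶜ*_ = Star _⟶ᶜ_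

lam* : ∀ {n} {t t' : Tm (suc n)} → t ⟶* t' → lam t ⟶* lam t'
lam* = gmap lam ξλ

app* : ∀ {n} {t t' : Tm n} {l l'} → t ⟶* t' → l ⟶ᶜ* l' → app t l ⟶* app t' l'
app* {t' = t'} {l = l} ts ls = gmap (λ z → app z l) ξ₁ ts ◅◅ gmap (app t') ξ₂ ls

∷* : ∀ {n} {u u' : Tm n} {l l'} → u ⟶* u' → l ⟶ᶜ* l' → (u ∷ l) ⟶ᶜ* (u' ∷ l')
∷* {u' = u'} {l = l} us ls = gmap (_∷ l) ξ∷₁ us ◅◅ gmap (u' ∷_) ξ∷₂ ls

bnd* : ∀ {n} {v v' : Tm (suc n)} → v ⟶* v' → bnd v ⟶ᶜ* bnd v'
bnd* = gmap bnd ξbnd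

app⟶*⊛ : ∀ {n} (t : Tm n) l → app t l ⟶* t ⊛ l
app⟶*⊛ t         (bnd v) = ε
app⟶*⊛ (var i)   (u ∷ l) = ε
app⟶*⊛ (lam t)   (u ∷ l) = ε
app⟶*⊛ (app t m) (u ∷ l) = π ◅ ε

mutual
  ⟶*πnf : ∀ {n} (t : Tm n) → t ⟶* πnf t
  ⟶*πnf (var i)   = ε
  ⟶*πnf (lam t)   = lam* (⟶*πnf t)
  ⟶*πnf (app t l) = app* (⟶*πnf t) (⟶ᶜ*πnfC l) ◅◅ app⟶*⊛ (πnf t) (πnfC l)

  ⟶ᶜ*πnfC : ∀ {n} (l : CoTm n) → l ⟶ᶜ* πnfC l
  ⟶ᶜ*πnfC (u ∷ l) = ∷* (⟶*πnf u) (⟶ᶜ*πnfC l)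
  ⟶ᶜ*πnfC (bnd v) = bnd* (⟶*πnf v)

mutual
  sub⟶*msub : ∀ {n m} (ρ : Sub n m) t → sub ρ t ⟶* msub ρ t
  sub⟶*msub ρ (var i)           = ε
  sub⟶*msub ρ (lam t)           = lam* (sub⟶*msub (extS ρ) t)
  sub⟶*msub ρ (app (var i) l)   = app* ε (subC⟶ᶜ*msubC ρ l) ◅◅ app⟶*⊛ (ρ i) (msubC ρ l)
  sub⟶*msub ρ (app (lam t) l)   = app* (sub⟶*msub ρ (lam t)) (subC⟶ᶜ*msubC ρ l)
  sub⟶*msub ρ (app (app t m) l) = app* (sub⟶*msub ρ (app t m)) (subC⟶ᶜ*msubC ρ l)

  subC⟶ᶜ*msubC : ∀ {n m} (ρ : Sub n m) l → subC ρ l ⟶ᶜ* msubC ρ l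
  subC⟶ᶜ*msubC ρ (u ∷ l) = ∷* (sub⟶*msub ρ u) (subC⟶ᶜ*msubC ρ l)
  subC⟶ᶜ*msubC ρ (bnd v) = bnd* (sub⟶*msub (extS ρ) v)

mutual
  ⇛⇒⟶* : ∀ {n} {t t' : Tm n} → t ⇛ t' → t ⟶* t'
  ⇛⇒⟶* pvar     = ε
  ⇛⇒⟶* (plam d) = lam* (⇛⇒⟶* d)
  ⇛⇒⟶* (papp {t' = t'} {l' = l'} d e) = app* (⇛⇒⟶* d) (⇛ᶜ⇒⟶ᶜ* e) ◅◅ app⟶*⊛ t' l'
  ⇛⇒⟶* (pσ {t' = t'} {v' = v'} d e) =
    app* (⇛⇒⟶* d) (bnd* (⇛⇒⟶* e)) ◅◅ σ ◅ sub⟶*msub (single t') v'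
  ⇛⇒⟶* (pβ {t' = t'} {l' = l'} d e f) =
    app* (lam* (⇛⇒⟶* d)) (∷* (⇛⇒⟶* e) (⇛ᶜ⇒⟶ᶜ* f)) ◅◅ β ◅ app* ε (bnd* (app⟶*⊛ t' (wkC l')))

  ⇛ᶜ⇒⟶ᶜ* : ∀ {n} {l l' : CoTm n} → l ⇛ᶜ l' → l ⟶ᶜ* l'
  ⇛ᶜ⇒⟶ᶜ* (pcons d e) = ∷* (⇛⇒⟶* d) (⇛ᶜ⇒⟶ᶜ* e)
  ⇛ᶜ⇒⟶ᶜ* (pbnd d)    = bnd* (⇛⇒⟶* d)
  ⇛ᶜ⇒⟶ᶜ* (pμ d)      = bnd* (⇛⇒⟶* d) ◅◅ μ ◅ ε

⇛*⇒⟶* : ∀ {n} {t t' : Tm n} → Star _⇛_ t t' → t ⟶* t'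
⇛*⇒⟶* ε        = ε
⇛*⇒⟶* (d ◅ ds) = ⇛⇒⟶* d ◅◅ ⇛*⇒⟶* ds

theorem3p5 : Confluent
theorem3p5 {t₁ = t₁} {t₂} t⟶*t₁ t⟶*t₂
  with triangle⇒confluent dev ⇛-dev (gmap πnf ⟶⇒πnf⇛ t⟶*t₁) (gmap πnf ⟶⇒πnf⇛ t⟶*t₂)
... | t₃ , πnft₁⇛*t₃ , πnft₂⇛*t₃ = t₃ , ⟶*πnf t₁ ◅◅ ⇛*⇒⟶* πnft₁⇛*t₃ , ⟶*πnf t₂ ◅◅ ⇛*⇒⟶* πnft₂⇛*t₃
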